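{- Let $q=4$, $V=\mathbb{F}_4^{\,5}$, and let $L$ be a simplex line. For $i=1,\dots,5$ let $P_i=L\cap C_i$, write $P_i=\langle x\rangle$ with $x=(x_1,\dots,x_5)$, $x_i=0$, and let $H_i$ be the hyperplane $\{y\in V:\sum_{j\ne i}x_j^{ -1}y_j=0\}$. For a simplex line $L'$ the following two conditions are equivalent: (1) $L'$ intersects every $H_i$ in a point contained in $H_i\cap C_i$ and distinct from $P_i$; (2) the distance between $L$ and $L'$ in $\Gamma$ is greater than $2$, or $L$ and $L'$ cannot be connected by a path in $\Gamma$.
   Context: $C_i=\{x\in V: x_i=0\}$ is the $i$-th coordinate hyperplane. A vector of $V$ is a simplex vector if precisely one of its coordinates is zero. A point is a $1$-dimensional subspace, a line a $2$-dimensional subspace. A simplex point is a point spanned by a simplex vector; a simplex line is a line all of whose non-zero vectors are simplex vectors; every simplex line meets each $C_i$ in exactly one point. $\Gamma$ is the graph whose vertices are all simplex lines, two distinct simplex lines being adjacent if their intersection is $1$-dimensional. (The hyperplane $H_i$ does not depend on the choice of the spanning vector $x$.) -}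

module Defs where

open import Data.Nat using (ℕ; zero; suc)
open import Data.Fin using (Fin)
open import Data.Vec using (Vec; lookup; zipWith; map; replicate; tabulate; foldr)
open import Data.Product using (Σ; ∃; _×_; _,_)
open import Relation.Nullary using (¬_; yes; no)
open import Relation.Binary.PropositionalEquality using (_≡_; _≢_)
open import Data.Fin using (_≟_)

data F4 : Set where
  𝟎 𝟏 ω ω² : F4

infixl 6 _⊕_
infixl 7 _⊗_

_⊕_ : F4 → F4 → F4
𝟎  ⊕ y  = y
x  ⊕ 𝟎  = x
𝟏  ⊕ 𝟏  = 𝟎
𝟏  ⊕ ω  = ω²
𝟏  ⊕ ω² = ω
ω  ⊕ 𝟏  = ω²
ω  ⊕ ω  = 𝟎
ω  ⊕ ω² = 𝟏
ω² ⊕ 𝟏  = ω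
ω² ⊕ ω  = 𝟏
ω² ⊕ ω² = 𝟎

_⊗_ : F4 → F4 → F4
𝟎  ⊗ y  = 𝟎
𝟏  ⊗ y  = y
ω  ⊗ 𝟎  = 𝟎
ω  ⊗ 𝟏  = ω
ω  ⊗ ω  = ω²
ω  ⊗ ω² = 𝟏
ω² ⊗ 𝟎  = 𝟎
ω² ⊗ 𝟏  = ω²
ω² ⊗ ω  = 𝟏
ω² ⊗ ω² = ω

-- multiplicative inverse (only used on non-zero elements; inv 𝟎 = 𝟎 by convention)
inv : F4 → F4
inv 𝟎  = 𝟎
inv 𝟏  = 𝟏
inv ω  = ω²
inv ω² = ω

-- V = F₄⁵ ; coordinates indexed by Fin 5 (i = 1,…,5 ↦ 0,…,4)
V : Set
V = Vec F4 5

0V : V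
0V = replicate 5 𝟎

_+V_ : V → V → V
_+V_ = zipWith _⊕_

_·_ : F4 → V → V
a · x = map (a ⊗_) x

sumF : ∀ {n} → Vec F4 n → F4
sumF = foldr _ _⊕_ 𝟎

InC : Fin 5 → V → Set
InC i x = lookup x i ≡ 𝟎

SimplexVector : V → Set
SimplexVector x = ∃ λ i → lookup x i ≡ 𝟎 × (∀ j → lookup x j ≡ 𝟎 → j ≡ i)

record Line : Set where
  constructor line
  field
    u v   : V
    indep : ∀ a b → (a · u) +V (b · v) ≡ 0V → (a ≡ 𝟎 × b ≡ 𝟎)

_∈L_ : V → Line → Set
y ∈L L = ∃ λ a → ∃ λ b → y ≡ (a · Line.u L) +V (b · Line.v L)

SameLine : Line → Line → Set
SameLine L M = (∀ y → y ∈L L → y ∈L M) × (∀ y → y ∈L M → y ∈L L)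

_∈⟨_⟩ : V → V → Set
y ∈⟨ z ⟩ = ∃ λ c → y ≡ c · z

SimplexLine : Line → Set
SimplexLine L = ∀ y → y ∈L L → y ≢ 0V → SimplexVector y

-- adjacency in Γ: distinct simplex lines whose intersection is 1-dimensional
-- (two distinct lines meet in a subspace of dimension ≤ 1, so it suffices
--  that they share a non-zero vector)
Adj : Line → Line → Set
Adj L M = SimplexLine L × SimplexLine M × ¬ SameLine L M
        × ∃ λ y → y ≢ 0V × y ∈L L × y ∈L M

-- walks of length n in Γ (vertices are simplex lines, identified up to SameLine)
data Walk : Line → Line → ℕ → Set where
  here : ∀ {L M} → SimplexLine L → SameLine L M → Walk L M zero
  step : ∀ {L M N n} → Adj L M → Walk M N n → Walk L N (suc n)

-- distance in Γ is > 2, or L and L' are not connected: no walk of length ≤ 2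
FarApart : Line → Line → Set
FarApart L L' = ∀ n → n Data.Nat.≤ 2 → ¬ Walk L L' n

InH : Fin 5 → V → V → Set
InH i x y = sumF (tabulate λ j → term j) ≡ 𝟎
  where
  term : Fin 5 → F4
  term j with j ≟ i
  ... | yes _ = 𝟎
  ... | no  _ = inv (lookup x j) ⊗ lookup y j

-- condition (1) for the index i and the spanning vector x of P_i = L ∩ C_i:
-- L' meets H_i in a point ⟨z⟩ (i.e. L' ∩ H_i = ⟨z⟩, z ≠ 0) with ⟨z⟩ ⊆ C_i and ⟨z⟩ ≠ P_i
MeetsWell : Fin 5 → V → Line → Set
MeetsWell i x L' =
  ∃ λ z → z ≢ 0V × z ∈L L' × InH i x z
        × (∀ y → y ∈L L' → InH i x y → y ∈⟨ z ⟩)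
        × InC i z
        × ¬ (z ∈⟨ x ⟩)

Condition1 : Line → Line → Set
Condition1 L L' = ∀ (i : Fin 5) (x : V) → x ≢ 0V → x ∈L L → InC i x → MeetsWell i x L'

-- Both conditions are unchanged when L and L' are replaced by other bases of the same subspaces,
-- and under invertible diagonal maps of V: these preserve the coordinate hyperplanes, simplex lines,
-- adjacency in Γ and the hyperplanes H_i (x_j⁻¹ y_j is unchanged when x_j and y_j are scaled alike).
-- Every simplex line is spanned by some (0, 1, a, b, c) and (1, 0, d, e, f), and a diagonal map moves
-- it to the line through (0, 1, 1, 1, 1) and (1, 0, 1, x, y) with {x, y} = {ω, ω²}. For these two
-- lines both conditions are decided by evaluation against each of the 162 canonical simplex lines L',
-- a path of length at most 2 being found among the same 162 lines.

module Submission where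

open import Defs

open import Data.Bool using (true)
open import Data.Empty using (⊥-elim)
open import Data.Fin using (Fin; zero; suc; #_; _≟_)
import Data.Fin.Properties as Fin
open import Data.List using (List; []; _∷_; map; concatMap)
open import Data.List.Membership.Propositional using (_∈_; find)
import Data.List.Membership.DecPropositional as DecMembership
open import Data.List.Relation.Unary.All as All using (All; all?)
open import Data.List.Relation.Unary.Any as Any using (Any; any?)
open import Data.Nat using (_≤_; z≤n; s≤s)
open import Data.Product using (∃; _×_; _,_; proj₁; proj₂)
import Data.Product.Properties as Product
open import Data.Sum using (_⊎_; inj₁; inj₂)
import Data.Vec as Vec
open import Data.Vec using ([]; _∷_; lookup; tabulate; zipWith)
open import Data.Vec.Properties
  using (≡-dec; lookup-map; lookup-zipWith; lookup-replicate; tabulate∘lookup; tabulate-cong)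
open import Function.Bundles using (_⇔_; mk⇔; Equivalence)
open import Function.Properties.Equivalence using (⇔-setoid)
open import Level using (0ℓ)
open import Relation.Binary.Definitions using (DecidableEquality)
open import Relation.Binary.PropositionalEquality using (_≡_; _≢_; refl; sym; trans; cong; cong₂; subst; subst₂)
open import Relation.Binary.PropositionalEquality.Properties using (module ≡-Reasoning)
import Relation.Binary.Reasoning.Setoid as SetoidReasoning
open import Relation.Nullary using (¬_; Dec; yes; no; does)
open import Relation.Nullary.Decidable using (map′; from-yes; _×-dec_; _⊎-dec_; _→-dec_; ¬?)
open import Relation.Unary using (Decidable)

module ⇔-Reasoning = SetoidReasoning (⇔-setoid 0ℓ)

-- Checking `refl : does d ≡ true` evaluates only the boolean; the proof inside d is never built,
-- which keeps the large finite checks below cheap in time and memory.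
by-evaluation : {A : Set} (d : Dec A) → does d ≡ true → A
by-evaluation (yes a) _ = a

infix 4 _≟F_
_≟F_ : DecidableEquality F4
𝟎  ≟F 𝟎  = yes refl
𝟎  ≟F 𝟏  = no λ ()
𝟎  ≟F ω  = no λ ()
𝟎  ≟F ω² = no λ ()
𝟏  ≟F 𝟎  = no λ ()
𝟏  ≟F 𝟏  = yes refl
𝟏  ≟F ω  = no λ ()
𝟏  ≟F ω² = no λ ()
ω  ≟F 𝟎  = no λ ()
ω  ≟F 𝟏  = no λ ()
ω  ≟F ω  = yes refl
ω  ≟F ω² = no λ ()
ω² ≟F 𝟎  = no λ ()
ω² ≟F 𝟏  = no λ ()
ω² ≟F ω  = no λ ()
ω² ≟F ω² = yes refl

∀F4? : {P : F4 → Set} → Decidable P → Dec (∀ a → P a)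
∀F4? P? = map′ (λ (p₀ , p₁ , p₂ , p₃) → λ { 𝟎 → p₀ ; 𝟏 → p₁ ; ω → p₂ ; ω² → p₃ })
               (λ h → h 𝟎 , h 𝟏 , h ω , h ω²)
               (P? 𝟎 ×-dec P? 𝟏 ×-dec P? ω ×-dec P? ω²)

∀unit? : {P : F4 → Set} → Decidable P → Dec (∀ a → a ≢ 𝟎 → P a)
∀unit? P? = ∀F4? λ a → ¬? (a ≟F 𝟎) →-dec P? a

∃F4? : {P : F4 → Set} → Decidable P → Dec (∃ P)
∃F4? P? = map′ (λ { (inj₁ p) → 𝟎 , p ; (inj₂ (inj₁ p)) → 𝟏 , p
                  ; (inj₂ (inj₂ (inj₁ p))) → ω , p ; (inj₂ (inj₂ (inj₂ p))) → ω² , p })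
               (λ { (𝟎 , p) → inj₁ p ; (𝟏 , p) → inj₂ (inj₁ p)
                  ; (ω , p) → inj₂ (inj₂ (inj₁ p)) ; (ω² , p) → inj₂ (inj₂ (inj₂ p)) })
               (P? 𝟎 ⊎-dec P? 𝟏 ⊎-dec P? ω ⊎-dec P? ω²)

x⊕𝟎≡x : ∀ x → x ⊕ 𝟎 ≡ x
x⊕𝟎≡x = from-yes (∀F4? λ x → x ⊕ 𝟎 ≟F x)

x⊕x≡𝟎 : ∀ x → x ⊕ x ≡ 𝟎
x⊕x≡𝟎 = from-yes (∀F4? λ x → x ⊕ x ≟F 𝟎)

x⊕y≡𝟎⇒x≡y : ∀ x y → x ⊕ y ≡ 𝟎 → x ≡ y
x⊕y≡𝟎⇒x≡y = from-yes (∀F4? λ x → ∀F4? λ y → (x ⊕ y ≟F 𝟎) →-dec (x ≟F y))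

x⊗𝟎≡𝟎 : ∀ x → x ⊗ 𝟎 ≡ 𝟎
x⊗𝟎≡𝟎 = from-yes (∀F4? λ x → x ⊗ 𝟎 ≟F 𝟎)

⊗-leftComm : ∀ x y z → x ⊗ (y ⊗ z) ≡ y ⊗ (x ⊗ z)
⊗-leftComm = from-yes (∀F4? λ x → ∀F4? λ y → ∀F4? λ z → x ⊗ (y ⊗ z) ≟F y ⊗ (x ⊗ z))

⊗-≢0 : ∀ x y → x ≢ 𝟎 → y ≢ 𝟎 → x ⊗ y ≢ 𝟎
⊗-≢0 = from-yes (∀F4? λ x → ∀F4? λ y → ¬? (x ≟F 𝟎) →-dec ¬? (y ≟F 𝟎) →-dec ¬? (x ⊗ y ≟F 𝟎))

inv-≢0 : ∀ x → x ≢ 𝟎 → inv x ≢ 𝟎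
inv-≢0 = from-yes (∀F4? λ x → ¬? (x ≟F 𝟎) →-dec ¬? (inv x ≟F 𝟎))

inv-inverseˡ : ∀ x → x ≢ 𝟎 → inv x ⊗ x ≡ 𝟏
inv-inverseˡ = from-yes (∀F4? λ x → ¬? (x ≟F 𝟎) →-dec (inv x ⊗ x ≟F 𝟏))

inv-cancelˡ : ∀ s x → s ≢ 𝟎 → inv s ⊗ (s ⊗ x) ≡ x
inv-cancelˡ = from-yes (∀F4? λ s → ∀F4? λ x → ¬? (s ≟F 𝟎) →-dec (inv s ⊗ (s ⊗ x) ≟F x))

inv-scale : ∀ s x y → s ≢ 𝟎 → inv (s ⊗ x) ⊗ (s ⊗ y) ≡ inv x ⊗ y
inv-scale = from-yes (∀F4? λ s → ∀F4? λ x → ∀F4? λ y →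
  ¬? (s ≟F 𝟎) →-dec (inv (s ⊗ x) ⊗ (s ⊗ y) ≟F inv x ⊗ y))

x⊗𝟏⊕y⊗𝟎≡x : ∀ x y → x ⊗ 𝟏 ⊕ y ⊗ 𝟎 ≡ x
x⊗𝟏⊕y⊗𝟎≡x = from-yes (∀F4? λ x → ∀F4? λ y → x ⊗ 𝟏 ⊕ y ⊗ 𝟎 ≟F x)

x⊗𝟎⊕y⊗𝟏≡y : ∀ x y → x ⊗ 𝟎 ⊕ y ⊗ 𝟏 ≡ y
x⊗𝟎⊕y⊗𝟏≡y = from-yes (∀F4? λ x → ∀F4? λ y → x ⊗ 𝟎 ⊕ y ⊗ 𝟏 ≟F y)

y⊗x⊕x⊗y≡𝟎 : ∀ x y → y ⊗ x ⊕ x ⊗ y ≡ 𝟎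
y⊗x⊕x⊗y≡𝟎 = from-yes (∀F4? λ x → ∀F4? λ y → y ⊗ x ⊕ x ⊗ y ≟F 𝟎)

comb-scale : ∀ c a b x y → c ⊗ (a ⊗ x ⊕ b ⊗ y) ≡ (c ⊗ a) ⊗ x ⊕ (c ⊗ b) ⊗ y
comb-scale = from-yes (∀F4? λ c → ∀F4? λ a → ∀F4? λ b → ∀F4? λ x → ∀F4? λ y →
  c ⊗ (a ⊗ x ⊕ b ⊗ y) ≟F (c ⊗ a) ⊗ x ⊕ (c ⊗ b) ⊗ y)

comb-add : ∀ a b c d x y → (a ⊗ x ⊕ b ⊗ y) ⊕ (c ⊗ x ⊕ d ⊗ y) ≡ (a ⊕ c) ⊗ x ⊕ (b ⊕ d) ⊗ y
comb-add = from-yes (∀F4? λ a → ∀F4? λ b → ∀F4? λ c → ∀F4? λ d → ∀F4? λ x → ∀F4? λ y →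
  (a ⊗ x ⊕ b ⊗ y) ⊕ (c ⊗ x ⊕ d ⊗ y) ≟F (a ⊕ c) ⊗ x ⊕ (b ⊕ d) ⊗ y)

comb-diag : ∀ s a b x y → s ⊗ (a ⊗ x ⊕ b ⊗ y) ≡ a ⊗ (s ⊗ x) ⊕ b ⊗ (s ⊗ y)
comb-diag = from-yes (∀F4? λ s → ∀F4? λ a → ∀F4? λ b → ∀F4? λ x → ∀F4? λ y →
  s ⊗ (a ⊗ x ⊕ b ⊗ y) ≟F a ⊗ (s ⊗ x) ⊕ b ⊗ (s ⊗ y))

infix 4 _≟V_
_≟V_ : DecidableEquality V
_≟V_ = ≡-dec _≟F_

V-ext : {x y : V} → (∀ j → lookup x j ≡ lookup y j) → x ≡ y
V-ext {x} {y} h = trans (sym (tabulate∘lookup x)) (trans (tabulate-cong h) (tabulate∘lookup y))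

lookup-0V : ∀ j → lookup 0V j ≡ 𝟎
lookup-0V j = lookup-replicate j 𝟎

lookup-· : ∀ c (x : V) j → lookup (c · x) j ≡ c ⊗ lookup x j
lookup-· c x j = lookup-map j (c ⊗_) x

lookup-comb : ∀ a b (x y : V) j → lookup ((a · x) +V (b · y)) j ≡ a ⊗ lookup x j ⊕ b ⊗ lookup y j
lookup-comb a b x y j =
  trans (lookup-zipWith _⊕_ j (a · x) (b · y)) (cong₂ _⊕_ (lookup-· a x j) (lookup-· b y j))

·-comb : ∀ c a b (x y : V) → c · ((a · x) +V (b · y)) ≡ ((c ⊗ a) · x) +V ((c ⊗ b) · y)
·-comb c a b x y = V-ext λ j → begin
  lookup (c · ((a · x) +V (b · y))) j         ≡⟨ lookup-· c ((a · x) +V (b · y)) j ⟩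
  c ⊗ lookup ((a · x) +V (b · y)) j          ≡⟨ cong (c ⊗_) (lookup-comb a b x y j) ⟩
  c ⊗ (a ⊗ lookup x j ⊕ b ⊗ lookup y j)      ≡⟨ comb-scale c a b _ _ ⟩
  (c ⊗ a) ⊗ lookup x j ⊕ (c ⊗ b) ⊗ lookup y j ≡⟨ lookup-comb (c ⊗ a) (c ⊗ b) x y j ⟨
  lookup (((c ⊗ a) · x) +V ((c ⊗ b) · y)) j  ∎
  where open ≡-Reasoning

+V-comb : ∀ a b c d (x y : V) →
          ((a · x) +V (b · y)) +V ((c · x) +V (d · y)) ≡ ((a ⊕ c) · x) +V ((b ⊕ d) · y)
+V-comb a b c d x y = V-ext λ j → begin
  lookup (((a · x) +V (b · y)) +V ((c · x) +V (d · y))) j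
    ≡⟨ lookup-zipWith _⊕_ j ((a · x) +V (b · y)) ((c · x) +V (d · y)) ⟩
  lookup ((a · x) +V (b · y)) j ⊕ lookup ((c · x) +V (d · y)) j
    ≡⟨ cong₂ _⊕_ (lookup-comb a b x y j) (lookup-comb c d x y j) ⟩
  (a ⊗ lookup x j ⊕ b ⊗ lookup y j) ⊕ (c ⊗ lookup x j ⊕ d ⊗ lookup y j)
    ≡⟨ comb-add a b c d _ _ ⟩
  (a ⊕ c) ⊗ lookup x j ⊕ (b ⊕ d) ⊗ lookup y j
    ≡⟨ lookup-comb (a ⊕ c) (b ⊕ d) x y j ⟨
  lookup (((a ⊕ c) · x) +V ((b ⊕ d) · y)) j ∎
  where open ≡-Reasoning

comb : Line → F4 → F4 → V
comb L a b = (a · Line.u L) +V (b · Line.v L)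

comb-unit₁ : ∀ L → comb L 𝟏 𝟎 ≡ Line.u L
comb-unit₁ L = V-ext λ j → trans (lookup-comb 𝟏 𝟎 (Line.u L) (Line.v L) j) (x⊕𝟎≡x _)

comb-unit₂ : ∀ L → comb L 𝟎 𝟏 ≡ Line.v L
comb-unit₂ L = V-ext λ j → lookup-comb 𝟎 𝟏 (Line.u L) (Line.v L) j

u∈L : ∀ L → Line.u L ∈L L
u∈L L = 𝟏 , 𝟎 , sym (comb-unit₁ L)

v∈L : ∀ L → Line.v L ∈L L
v∈L L = 𝟎 , 𝟏 , sym (comb-unit₂ L)

u≢0V : ∀ L → Line.u L ≢ 0V
u≢0V L u≡0 with Line.indep L 𝟏 𝟎 (trans (comb-unit₁ L) u≡0)
... | () , _

v≢0V : ∀ L → Line.v L ≢ 0V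
v≢0V L v≡0 with Line.indep L 𝟎 𝟏 (trans (comb-unit₂ L) v≡0)
... | _ , ()

∈L-scale : ∀ L {y} c → y ∈L L → (c · y) ∈L L
∈L-scale L c (a , b , refl) = c ⊗ a , c ⊗ b , ·-comb c a b (Line.u L) (Line.v L)

∈L-comb : ∀ L {y z} α β → y ∈L L → z ∈L L → ((α · y) +V (β · z)) ∈L L
∈L-comb L α β (a , b , refl) (c , d , refl) =
  α ⊗ a ⊕ β ⊗ c , α ⊗ b ⊕ β ⊗ d ,
  trans (cong₂ _+V_ (·-comb α a b u v) (·-comb β c d u v)) (+V-comb (α ⊗ a) (α ⊗ b) (β ⊗ c) (β ⊗ d) u v)
  where open Line L

record _≈L_ (L M : Line) : Set where
  constructor mk≈L
  field sameLine : SameLine L M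

  ⊆ : ∀ y → y ∈L L → y ∈L M
  ⊆ = proj₁ sameLine

  ⊇ : ∀ y → y ∈L M → y ∈L L
  ⊇ = proj₂ sameLine

open _≈L_

≈L-refl : ∀ {L} → L ≈L L
≈L-refl = mk≈L ((λ _ h → h) , (λ _ h → h))

≈L-sym : ∀ {L M} → L ≈L M → M ≈L L
≈L-sym (mk≈L (f , g)) = mk≈L (g , f)

≈L-trans : ∀ {L M N} → L ≈L M → M ≈L N → L ≈L N
≈L-trans L≈M M≈N = mk≈L ((λ y h → ⊆ M≈N y (⊆ L≈M y h)) , (λ y h → ⊇ L≈M y (⊇ M≈N y h)))

≈L-byBasis : ∀ {L M} → Line.u L ∈L M → Line.v L ∈L M → Line.u M ∈L L → Line.v M ∈L L → L ≈L M
≈L-byBasis {L} {M} uL vL uM vM =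
  mk≈L ((λ { _ (a , b , refl) → ∈L-comb M a b uL vL }) , (λ { _ (a , b , refl) → ∈L-comb L a b uM vM }))

≈L-sameBasis : ∀ {L M} → Line.u L ≡ Line.u M → Line.v L ≡ Line.v M → L ≈L M
≈L-sameBasis {L} {M} refl refl = ≈L-byBasis (u∈L M) (v∈L M) (u∈L L) (v∈L L)

Meets : Line → Line → Set
Meets L M = ∃ λ y → y ≢ 0V × y ∈L L × y ∈L M

Meets-self : ∀ L → Meets L L
Meets-self L = Line.u L , u≢0V L , u∈L L , u∈L L

Meets-respˡ : ∀ {L M N} → L ≈L M → Meets L N → Meets M N
Meets-respˡ L≈M (y , y≢0 , yL , yN) = y , y≢0 , ⊆ L≈M y yL , yN

Meets-respʳ : ∀ {L M N} → M ≈L N → Meets L M → Meets L N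
Meets-respʳ M≈N (y , y≢0 , yL , yM) = y , y≢0 , yL , ⊆ M≈N y yM

SimplexLine-resp : ∀ {L M} → L ≈L M → SimplexLine L → SimplexLine M
SimplexLine-resp L≈M sL y yM = sL y (⊇ L≈M y yM)

Adj-respˡ : ∀ {L K M} → L ≈L K → Adj L M → Adj K M
Adj-respˡ {K = K} {M} L≈K (sL , sM , L≉M , m) =
  SimplexLine-resp L≈K sL , sM , (λ K≈M → L≉M (sameLine (≈L-trans L≈K (mk≈L {K} {M} K≈M)))) ,
  Meets-respˡ {N = M} L≈K m

Walk-respˡ : ∀ {L K N n} → L ≈L K → Walk L N n → Walk K N n
Walk-respˡ L≈K (here {L} {N} sL L≈N) =
  here (SimplexLine-resp L≈K sL) (sameLine (≈L-trans (≈L-sym L≈K) (mk≈L {L} {N} L≈N)))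
Walk-respˡ L≈K (step {M = M} a w)    = step (Adj-respˡ {M = M} L≈K a) w

Walk-respʳ : ∀ {L N K n} → N ≈L K → Walk L N n → Walk L K n
Walk-respʳ N≈K (here {L} {N} sL L≈N) = here sL (sameLine (≈L-trans (mk≈L {L} {N} L≈N) N≈K))
Walk-respʳ N≈K (step a w)            = step a (Walk-respʳ N≈K w)

FarApart-cong : ∀ {L L' K K'} → L ≈L K → L' ≈L K' → FarApart L L' ⇔ FarApart K K'
FarApart-cong L≈K L'≈K' = mk⇔ (resp (≈L-sym L≈K) (≈L-sym L'≈K')) (resp L≈K L'≈K')
  where
  resp : ∀ {L L' K K'} → K ≈L L → K' ≈L L' → FarApart L L' → FarApart K K'
  resp K≈L K'≈L' far n n≤2 w = far n n≤2 (Walk-respʳ K'≈L' (Walk-respˡ K≈L w))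

MeetsWell-resp : ∀ {i x L' K'} → L' ≈L K' → MeetsWell i x L' → MeetsWell i x K'
MeetsWell-resp L'≈K' (z , z≢0 , zL' , zH , unique , zC , z∉x) =
  z , z≢0 , ⊆ L'≈K' z zL' , zH , (λ y yK' → unique y (⊇ L'≈K' y yK')) , zC , z∉x

Condition1-cong : ∀ {L L' K K'} → L ≈L K → L' ≈L K' → Condition1 L L' ⇔ Condition1 K K'
Condition1-cong L≈K L'≈K' = mk⇔ (resp L≈K L'≈K') (resp (≈L-sym L≈K) (≈L-sym L'≈K'))
  where
  resp : ∀ {L L' K K'} → L ≈L K → L' ≈L K' → Condition1 L L' → Condition1 K K'
  resp L≈K L'≈K' c1 i x x≢0 xK xC = MeetsWell-resp L'≈K' (c1 i x x≢0 (⊇ L≈K x xK) xC)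

-- Invertible diagonal maps

record Diagonal : Set where
  constructor diag
  field
    entries   : V
    entries≢0 : ∀ j → lookup entries j ≢ 𝟎

open Diagonal

infixr 7 _⊙_ _⊙L_

_⊙_ : Diagonal → V → V
D ⊙ x = zipWith _⊗_ (entries D) x

_⁻¹ : Diagonal → Diagonal
D ⁻¹ = diag (Vec.map inv (entries D))
            (λ j → subst (_≢ 𝟎) (sym (lookup-map j inv (entries D))) (inv-≢0 _ (entries≢0 D j)))

lookup-⊙ : ∀ D x j → lookup (D ⊙ x) j ≡ lookup (entries D) j ⊗ lookup x j
lookup-⊙ D x j = lookup-zipWith _⊗_ j (entries D) x

⊙-comb : ∀ D a b x y → D ⊙ ((a · x) +V (b · y)) ≡ (a · (D ⊙ x)) +V (b · (D ⊙ y))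
⊙-comb D a b x y = V-ext coordinate
  where
  open ≡-Reasoning
  coordinate : ∀ j → lookup (D ⊙ ((a · x) +V (b · y))) j ≡ lookup ((a · (D ⊙ x)) +V (b · (D ⊙ y))) j
  coordinate j = begin
    lookup (D ⊙ ((a · x) +V (b · y))) j             ≡⟨ lookup-⊙ D ((a · x) +V (b · y)) j ⟩
    dⱼ ⊗ lookup ((a · x) +V (b · y)) j              ≡⟨ cong (dⱼ ⊗_) (lookup-comb a b x y j) ⟩
    dⱼ ⊗ (a ⊗ lookup x j ⊕ b ⊗ lookup y j)          ≡⟨ comb-diag dⱼ a b _ _ ⟩
    a ⊗ (dⱼ ⊗ lookup x j) ⊕ b ⊗ (dⱼ ⊗ lookup y j)
      ≡⟨ cong₂ (λ p q → a ⊗ p ⊕ b ⊗ q) (lookup-⊙ D x j) (lookup-⊙ D y j) ⟨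
    a ⊗ lookup (D ⊙ x) j ⊕ b ⊗ lookup (D ⊙ y) j     ≡⟨ lookup-comb a b (D ⊙ x) (D ⊙ y) j ⟨
    lookup ((a · (D ⊙ x)) +V (b · (D ⊙ y))) j       ∎
    where
    dⱼ = lookup (entries D) j

⊙-· : ∀ D c x → D ⊙ (c · x) ≡ c · (D ⊙ x)
⊙-· D c x = V-ext λ j → begin
  lookup (D ⊙ (c · x)) j                   ≡⟨ lookup-⊙ D (c · x) j ⟩
  lookup (entries D) j ⊗ lookup (c · x) j  ≡⟨ cong (lookup (entries D) j ⊗_) (lookup-· c x j) ⟩
  lookup (entries D) j ⊗ (c ⊗ lookup x j)  ≡⟨ ⊗-leftComm (lookup (entries D) j) c (lookup x j) ⟩
  c ⊗ (lookup (entries D) j ⊗ lookup x j)  ≡⟨ cong (c ⊗_) (lookup-⊙ D x j) ⟨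
  c ⊗ lookup (D ⊙ x) j                     ≡⟨ lookup-· c (D ⊙ x) j ⟨
  lookup (c · (D ⊙ x)) j                   ∎
  where open ≡-Reasoning

⊙-0V : ∀ D → D ⊙ 0V ≡ 0V
⊙-0V D = V-ext λ j → trans (lookup-⊙ D 0V j) (trans (cong (lookup (entries D) j ⊗_) (lookup-0V j))
                                                     (trans (x⊗𝟎≡𝟎 _) (sym (lookup-0V j))))

⊙-inverseˡ : ∀ D x → D ⁻¹ ⊙ (D ⊙ x) ≡ x
⊙-inverseˡ D x = V-ext λ j →
  trans (lookup-⊙ (D ⁻¹) (D ⊙ x) j)
        (trans (cong₂ _⊗_ (lookup-map j inv (entries D)) (lookup-⊙ D x j))
               (inv-cancelˡ _ _ (entries≢0 D j)))

⊙-injective : ∀ D {x y} → D ⊙ x ≡ D ⊙ y → x ≡ y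
⊙-injective D {x} {y} eq = trans (sym (⊙-inverseˡ D x)) (trans (cong (D ⁻¹ ⊙_) eq) (⊙-inverseˡ D y))

⊙-≢0V : ∀ D {x} → x ≢ 0V → D ⊙ x ≢ 0V
⊙-≢0V D x≢0 eq = x≢0 (⊙-injective D (trans eq (sym (⊙-0V D))))

InC-⊙ : ∀ D {i x} → InC i x → InC i (D ⊙ x)
InC-⊙ D {i} {x} xᵢ≡0 = trans (lookup-⊙ D x i) (trans (cong (lookup (entries D) i ⊗_) xᵢ≡0) (x⊗𝟎≡𝟎 _))

InC-⊙⁻ : ∀ D {i x} → InC i (D ⊙ x) → InC i x
InC-⊙⁻ D {i} {x} h = subst (InC i) (⊙-inverseˡ D x) (InC-⊙ (D ⁻¹) h)

-- The summand of InH is local to its definition; this copy lets us reason about it pointwise.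
hyperplane-term : Fin 5 → V → V → Fin 5 → F4
hyperplane-term i x y j with j ≟ i
... | yes _ = 𝟎
... | no  _ = inv (lookup x j) ⊗ lookup y j

InH-unfold : ∀ i x y → InH i x y ≡ (sumF (tabulate (hyperplane-term i x y)) ≡ 𝟎)
InH-unfold zero                            x y = refl
InH-unfold (suc zero)                      x y = refl
InH-unfold (suc (suc zero))                x y = refl
InH-unfold (suc (suc (suc zero)))          x y = refl
InH-unfold (suc (suc (suc (suc zero))))    x y = refl

hyperplane-term-⊙ : ∀ D i x y j → hyperplane-term i (D ⊙ x) (D ⊙ y) j ≡ hyperplane-term i x y j
hyperplane-term-⊙ D i x y j with j ≟ i
... | yes _ = refl
... | no  _ =
  trans (cong₂ (λ p q → inv p ⊗ q) (lookup-⊙ D x j) (lookup-⊙ D y j)) (inv-scale _ _ _ (entries≢0 D j))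

InH-⊙ : ∀ D i x y → InH i x y → InH i (D ⊙ x) (D ⊙ y)
InH-⊙ D i x y h =
  subst (λ A → A) (sym (InH-unfold i (D ⊙ x) (D ⊙ y)))
        (trans (cong sumF (tabulate-cong (hyperplane-term-⊙ D i x y))) (subst (λ A → A) (InH-unfold i x y) h))

InH-⊙⁻ : ∀ D i x y → InH i (D ⊙ x) (D ⊙ y) → InH i x y
InH-⊙⁻ D i x y h = subst₂ (InH i) (⊙-inverseˡ D x) (⊙-inverseˡ D y) (InH-⊙ (D ⁻¹) i (D ⊙ x) (D ⊙ y) h)

_⊙L_ : Diagonal → Line → Line
D ⊙L L = line (D ⊙ u) (D ⊙ v)
  λ a b eq → indep a b (⊙-injective D (trans (⊙-comb D a b u v) (trans eq (sym (⊙-0V D)))))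
  where open Line L

∈-⊙L : ∀ D L {y} → y ∈L L → (D ⊙ y) ∈L (D ⊙L L)
∈-⊙L D L (a , b , refl) = a , b , ⊙-comb D a b (Line.u L) (Line.v L)

∈-⊙L⁻ : ∀ D L {y'} → y' ∈L (D ⊙L L) → ∃ λ y → y ∈L L × y' ≡ D ⊙ y
∈-⊙L⁻ D L (a , b , refl) = comb L a b , (a , b , refl) , sym (⊙-comb D a b (Line.u L) (Line.v L))

⊙L-cong : ∀ D {L M} → L ≈L M → (D ⊙L L) ≈L (D ⊙L M)
⊙L-cong D {L} {M} L≈M =
  ≈L-byBasis (∈-⊙L D M (⊆ L≈M _ (u∈L L))) (∈-⊙L D M (⊆ L≈M _ (v∈L L)))
             (∈-⊙L D L (⊇ L≈M _ (u∈L M))) (∈-⊙L D L (⊇ L≈M _ (v∈L M)))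

⊙L-inverseˡ : ∀ D L → (D ⁻¹ ⊙L (D ⊙L L)) ≈L L
⊙L-inverseˡ D L = ≈L-sameBasis {D ⁻¹ ⊙L (D ⊙L L)} {L} (⊙-inverseˡ D (Line.u L)) (⊙-inverseˡ D (Line.v L))

⊙L-cancel : ∀ D {L M} → (D ⊙L L) ≈L (D ⊙L M) → L ≈L M
⊙L-cancel D {L} {M} DL≈DM =
  ≈L-trans {L} {D ⁻¹ ⊙L (D ⊙L L)} {M} (≈L-sym {D ⁻¹ ⊙L (D ⊙L L)} {L} (⊙L-inverseˡ D L))
    (≈L-trans {D ⁻¹ ⊙L (D ⊙L L)} {D ⁻¹ ⊙L (D ⊙L M)} {M}
      (⊙L-cong (D ⁻¹) {D ⊙L L} {D ⊙L M} DL≈DM) (⊙L-inverseˡ D M))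

SimplexLine-⊙L : ∀ D L → SimplexLine L → SimplexLine (D ⊙L L)
SimplexLine-⊙L D L sL y' y'∈ y'≢0 with ∈-⊙L⁻ D L y'∈
... | y , yL , refl with sL y yL (λ y≡0 → y'≢0 (trans (cong (D ⊙_) y≡0) (⊙-0V D)))
...   | k , yₖ≡0 , unique = k , InC-⊙ D yₖ≡0 , λ j h → unique j (InC-⊙⁻ D h)

Adj-⊙L : ∀ D {L M} → Adj L M → Adj (D ⊙L L) (D ⊙L M)
Adj-⊙L D {L} {M} (sL , sM , L≉M , y , y≢0 , yL , yM) =
  SimplexLine-⊙L D L sL , SimplexLine-⊙L D M sM ,
  (λ DL≈DM → L≉M (sameLine {L} {M} (⊙L-cancel D {L} {M} (mk≈L {D ⊙L L} {D ⊙L M} DL≈DM)))) ,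
  D ⊙ y , ⊙-≢0V D y≢0 , ∈-⊙L D L yL , ∈-⊙L D M yM

Walk-⊙L : ∀ D {L M n} → Walk L M n → Walk (D ⊙L L) (D ⊙L M) n
Walk-⊙L D (here {L} {M} sL L≈M) =
  here {D ⊙L L} {D ⊙L M} (SimplexLine-⊙L D L sL) (sameLine (⊙L-cong D {L} {M} (mk≈L {L} {M} L≈M)))
Walk-⊙L D (step {L} {M} {N} a w) = step {D ⊙L L} {D ⊙L M} {D ⊙L N} (Adj-⊙L D {L} {M} a) (Walk-⊙L D {M} {N} w)

Walk-⊙L⁻ : ∀ D {L M n} → Walk (D ⊙L L) (D ⊙L M) n → Walk L M n
Walk-⊙L⁻ D {L} {M} w =
  Walk-respʳ {L} {D ⁻¹ ⊙L (D ⊙L M)} {M} (⊙L-inverseˡ D M)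
    (Walk-respˡ {D ⁻¹ ⊙L (D ⊙L L)} {L} {D ⁻¹ ⊙L (D ⊙L M)} (⊙L-inverseˡ D L)
      (Walk-⊙L (D ⁻¹) {D ⊙L L} {D ⊙L M} w))

FarApart-⊙L : ∀ D {L L'} → FarApart L L' ⇔ FarApart (D ⊙L L) (D ⊙L L')
FarApart-⊙L D {L} {L'} = mk⇔
  (λ far n n≤2 w → far n n≤2 (Walk-⊙L⁻ D w))
  (λ far n n≤2 w → far n n≤2 (Walk-⊙L D {L} {L'} w))

MeetsWell-⊙L : ∀ D {i x L'} → MeetsWell i x L' → MeetsWell i (D ⊙ x) (D ⊙L L')
MeetsWell-⊙L D {i} {x} {L'} (z , z≢0 , zL' , zH , unique , zC , z∉x) =
  D ⊙ z , ⊙-≢0V D z≢0 , ∈-⊙L D L' zL' , InH-⊙ D i x z zH , unique' , InC-⊙ D zC ,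
  λ (c , eq) → z∉x (c , ⊙-injective D (trans eq (sym (⊙-· D c x))))
  where
  unique' : ∀ y' → y' ∈L (D ⊙L L') → InH i (D ⊙ x) y' → y' ∈⟨ D ⊙ z ⟩
  unique' y' y'∈ y'H with ∈-⊙L⁻ D L' y'∈
  ... | y , yL' , refl with unique y yL' (InH-⊙⁻ D i x y y'H)
  ...   | c , refl = c , ⊙-· D c z

Condition1-⊙L : ∀ D {L L'} → Condition1 L L' ⇔ Condition1 (D ⊙L L) (D ⊙L L')
Condition1-⊙L D {L} {L'} = mk⇔ (preserve D {L} {L'})
  (λ c1 → Equivalence.to (Condition1-cong (⊙L-inverseˡ D L) (⊙L-inverseˡ D L'))
                          (preserve (D ⁻¹) {D ⊙L L} {D ⊙L L'} c1))
  where
  preserve : ∀ D {L L'} → Condition1 L L' → Condition1 (D ⊙L L) (D ⊙L L')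
  preserve D {L} {L'} c1 i x' x'≢0 x'∈ x'C with ∈-⊙L⁻ D L x'∈
  ... | x , xL , refl =
    MeetsWell-⊙L D {i} {x} {L'} (c1 i x (λ x≡0 → x'≢0 (trans (cong (D ⊙_) x≡0) (⊙-0V D))) xL (InC-⊙⁻ D x'C))

-- Normal form of a simplex line

simplex-two-zeros : ∀ L → SimplexLine L → ∀ y → y ∈L L → ∀ {i j} → InC i y → InC j y → i ≢ j → y ≡ 0V
simplex-two-zeros L sL y yL yi yj i≢j with y ≟V 0V
... | yes y≡0 = y≡0
... | no  y≢0 with sL y yL y≢0
...   | _ , _ , unique = ⊥-elim (i≢j (trans (unique _ yi) (sym (unique _ yj))))

simplex-coordinate≢0 : ∀ L {y i j} → SimplexLine L → y ∈L L → y ≢ 0V → InC i y → i ≢ j → lookup y j ≢ 𝟎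
simplex-coordinate≢0 L {y} {i} {j} sL yL y≢0 yi i≢j yj = y≢0 (simplex-two-zeros L sL y yL {i} {j} yi yj i≢j)

∃-∈L-InC : ∀ L k → ∃ λ y → y ≢ 0V × y ∈L L × InC k y
∃-∈L-InC L k with lookup (Line.u L) k ≟F 𝟎
... | yes uₖ≡0 = Line.u L , u≢0V L , u∈L L , uₖ≡0
... | no  uₖ≢0 = comb L vₖ uₖ , (λ eq → uₖ≢0 (proj₂ (Line.indep L vₖ uₖ eq))) , (vₖ , uₖ , refl) ,
                 trans (lookup-comb vₖ uₖ (Line.u L) (Line.v L) k) (y⊗x⊕x⊗y≡𝟎 uₖ vₖ)
  where
  uₖ = lookup (Line.u L) k
  vₖ = lookup (Line.v L) k

unit-vector : ∀ L → SimplexLine L → ∀ k j → k ≢ j → ∃ λ y → y ∈L L × InC k y × lookup y j ≡ 𝟏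
unit-vector L sL k j k≢j with ∃-∈L-InC L k
... | y , y≢0 , yL , yk =
  inv (lookup y j) · y , ∈L-scale L _ yL ,
  trans (lookup-· _ y k) (trans (cong (inv (lookup y j) ⊗_) yk) (x⊗𝟎≡𝟎 _)) ,
  trans (lookup-· _ y j) (inv-inverseˡ _ (simplex-coordinate≢0 L sL yL y≢0 yk k≢j))

Params : Set
Params = F4 × F4 × F4 × F4 × F4 × F4

canonical : Params → Line
canonical (a , b , c , d , e , f) = line (𝟎 ∷ 𝟏 ∷ a ∷ b ∷ c ∷ []) (𝟏 ∷ 𝟎 ∷ d ∷ e ∷ f ∷ [])
  λ α β eq → trans (sym (x⊗𝟏⊕y⊗𝟎≡x α β)) (cong (λ y → lookup y (# 1)) eq) ,
             trans (sym (x⊗𝟎⊕y⊗𝟏≡y α β)) (cong (λ y → lookup y (# 0)) eq)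

∈canonical⇔ : ∀ p y → y ∈L canonical p ⇔ y ≡ comb (canonical p) (lookup y (# 1)) (lookup y (# 0))
∈canonical⇔ p@(_ , _ , _ , _ , _ , _) y = mk⇔
  (λ { (α , β , refl) → cong₂ (comb (canonical p)) (sym (x⊗𝟏⊕y⊗𝟎≡x α β)) (sym (x⊗𝟎⊕y⊗𝟏≡y α β)) })
  (λ eq → lookup y (# 1) , lookup y (# 0) , eq)

-- Subtracting from w the combination with the same first two coordinates leaves a vector of the
-- line with two zeros.
canonical-⊇ : ∀ L p → SimplexLine L → Line.u (canonical p) ∈L L → Line.v (canonical p) ∈L L →
              ∀ w → w ∈L L → w ∈L canonical p
canonical-⊇ L p@(_ , _ , _ , _ , _ , _) sL P∈L Q∈L w wL = w₁ , w₀ , V-ext λ k → x⊕y≡𝟎⇒x≡y _ _ (w+r≡0 k)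
  where
  w₀ w₁ : F4
  w₀ = lookup w (# 0)
  w₁ = lookup w (# 1)

  r s : V
  r = comb (canonical p) w₁ w₀
  s = (𝟏 · w) +V (𝟏 · r)

  s≡0 : s ≡ 0V
  s≡0 = simplex-two-zeros L sL s (∈L-comb L 𝟏 𝟏 wL (∈L-comb L {Line.u (canonical p)} w₁ w₀ P∈L Q∈L)) {# 0} {# 1}
          (trans (lookup-comb 𝟏 𝟏 w r (# 0)) (trans (cong (w₀ ⊕_) (x⊗𝟎⊕y⊗𝟏≡y w₁ w₀)) (x⊕x≡𝟎 w₀)))
          (trans (lookup-comb 𝟏 𝟏 w r (# 1)) (trans (cong (w₁ ⊕_) (x⊗𝟏⊕y⊗𝟎≡x w₁ w₀)) (x⊕x≡𝟎 w₁)))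
          λ ()

  w+r≡0 : ∀ k → lookup w k ⊕ lookup r k ≡ 𝟎
  w+r≡0 k = trans (sym (lookup-comb 𝟏 𝟏 w r k)) (trans (cong (λ y → lookup y k) s≡0) (lookup-0V k))

canonical-≈ : ∀ L p → SimplexLine L → Line.u (canonical p) ∈L L → Line.v (canonical p) ∈L L →
              L ≈L canonical p
canonical-≈ L p sL P∈L Q∈L = mk≈L {L} {canonical p}
  (canonical-⊇ L p sL P∈L Q∈L ,
   λ { _ (α , β , refl) → ∈L-comb L {Line.u (canonical p)} {Line.v (canonical p)} α β P∈L Q∈L })

canonical-entries≢0 : ∀ a b c d e f → SimplexLine (canonical (a , b , c , d , e , f)) →
                      a ≢ 𝟎 × b ≢ 𝟎 × c ≢ 𝟎 × d ≢ 𝟎 × e ≢ 𝟎 × f ≢ 𝟎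
canonical-entries≢0 a b c d e f sL =
  P≢0 (# 2) (λ ()) , P≢0 (# 3) (λ ()) , P≢0 (# 4) (λ ()) ,
  Q≢0 (# 2) (λ ()) , Q≢0 (# 3) (λ ()) , Q≢0 (# 4) (λ ())
  where
  L = canonical (a , b , c , d , e , f)
  P≢0 : ∀ j → # 0 ≢ j → lookup (Line.u L) j ≢ 𝟎
  P≢0 j = simplex-coordinate≢0 L sL (u∈L L) (u≢0V L) refl
  Q≢0 : ∀ j → # 1 ≢ j → lookup (Line.v L) j ≢ 𝟎
  Q≢0 j = simplex-coordinate≢0 L sL (v∈L L) (v≢0V L) refl

fix-coordinates₀₁ : ∀ {y : V} {a b} → lookup y (# 0) ≡ a → lookup y (# 1) ≡ b →
                    y ≡ a ∷ b ∷ lookup y (# 2) ∷ lookup y (# 3) ∷ lookup y (# 4) ∷ []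
fix-coordinates₀₁ {_ ∷ _ ∷ _ ∷ _ ∷ _ ∷ []} refl refl = refl

normal-form : ∀ L → SimplexLine L → ∃ λ p → L ≈L canonical p
normal-form L sL with unit-vector L sL (# 0) (# 1) (λ ()) | unit-vector L sL (# 1) (# 0) (λ ())
... | P , P∈L , P₀ , P₁ | Q , Q∈L , Q₁ , Q₀ =
  p , canonical-≈ L p sL (subst (_∈L L) (fix-coordinates₀₁ {P} P₀ P₁) P∈L)
                         (subst (_∈L L) (fix-coordinates₀₁ {Q} Q₀ Q₁) Q∈L)
  where
  p = lookup P (# 2) , lookup P (# 3) , lookup P (# 4) , lookup Q (# 2) , lookup Q (# 3) , lookup Q (# 4)

_⇔?_ : {A B : Set} → Dec A → Dec B → Dec (A ⇔ B)
yes a ⇔? yes b = yes (mk⇔ (λ _ → b) (λ _ → a))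
yes a ⇔? no ¬b = no λ a⇔b → ¬b (Equivalence.to a⇔b a)
no ¬a ⇔? yes b = no λ a⇔b → ¬a (Equivalence.from a⇔b b)
no ¬a ⇔? no ¬b = yes (mk⇔ (λ a → ⊥-elim (¬a a)) (λ b → ⊥-elim (¬b b)))

∀∈L? : ∀ L {P : V → Set} → Decidable P → Dec (∀ y → y ∈L L → P y)
∀∈L? L P? = map′ (λ h → λ { _ (a , b , refl) → h a b }) (λ h a b → h _ (a , b , refl))
                 (∀F4? λ a → ∀F4? λ b → P? (comb L a b))

∃∈L? : ∀ L {P : V → Set} → Decidable P → Dec (∃ λ y → y ∈L L × P y)
∃∈L? L P? = map′ (λ (a , b , p) → comb L a b , (a , b , refl) , p) (λ { (_ , (a , b , refl) , p) → a , b , p })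
                 (∃F4? λ a → ∃F4? λ b → P? (comb L a b))

simplexVector? : Decidable SimplexVector
simplexVector? y = Fin.any? λ i → (lookup y i ≟F 𝟎) ×-dec Fin.all? λ j → (lookup y j ≟F 𝟎) →-dec (j ≟ i)

simplexLine? : Decidable SimplexLine
simplexLine? L = ∀∈L? L λ y → ¬? (y ≟V 0V) →-dec simplexVector? y

_∈L?_ : ∀ y L → Dec (y ∈L L)
y ∈L? L = ∃F4? λ a → ∃F4? λ b → y ≟V comb L a b

_≈L?_ : ∀ L M → Dec (L ≈L M)
L ≈L? M = map′ mk≈L sameLine (∀∈L? L (_∈L? M) ×-dec ∀∈L? M (_∈L? L))

∈canonical? : ∀ p y → Dec (y ∈L canonical p)
∈canonical? p y = map′ (Equivalence.from (∈canonical⇔ p y)) (Equivalence.to (∈canonical⇔ p y)) (y ≟V _)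

meets? : ∀ L M → (∀ y → Dec (y ∈L M)) → Dec (Meets L M)
meets? L M _∈M? = map′ (λ (y , yL , y≢0 , yM) → y , y≢0 , yL , yM) (λ (y , y≢0 , yL , yM) → y , yL , y≢0 , yM)
                       (∃∈L? L λ y → ¬? (y ≟V 0V) ×-dec y ∈M?)

InH? : ∀ i x y → Dec (InH i x y)
InH? i x y = _ ≟F 𝟎

_∈⟨_⟩? : ∀ y z → Dec (y ∈⟨ z ⟩)
y ∈⟨ z ⟩? = ∃F4? λ c → y ≟V c · z

meetsWell? : ∀ i x L' → Dec (MeetsWell i x L')
meetsWell? i x L' =
  map′ (λ (z , zL' , z≢0 , zH , unique , zC , z∉x) → z , z≢0 , zL' , zH , unique , zC , z∉x)
       (λ (z , z≢0 , zL' , zH , unique , zC , z∉x) → z , zL' , z≢0 , zH , unique , zC , z∉x)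
       (∃∈L? L' λ z → ¬? (z ≟V 0V) ×-dec InH? i x z ×-dec
                      ∀∈L? L' (λ y → InH? i x y →-dec y ∈⟨ z ⟩?) ×-dec (lookup z i ≟F 𝟎) ×-dec ¬? (z ∈⟨ x ⟩?))

condition1? : ∀ L L' → Dec (Condition1 L L')
condition1? L L' =
  map′ (λ h i x x≢0 xL xC → h i x xL x≢0 xC) (λ h i x xL x≢0 xC → h i x x≢0 xL xC)
       (Fin.all? λ i → ∀∈L? L λ x → ¬? (x ≟V 0V) →-dec (lookup x i ≟F 𝟎) →-dec meetsWell? i x L')

_≟P_ : DecidableEquality Params
_≟P_ = Product.≡-dec _≟F_ (Product.≡-dec _≟F_ (Product.≡-dec _≟F_
          (Product.≡-dec _≟F_ (Product.≡-dec _≟F_ _≟F_))))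

open DecMembership _≟P_ using (_∈?_)

units : List F4
units = 𝟏 ∷ ω ∷ ω² ∷ []

unit-arrangements : List (F4 × F4 × F4)
unit-arrangements = (𝟏 , ω , ω²) ∷ (𝟏 , ω² , ω) ∷ (ω , 𝟏 , ω²) ∷ (ω , ω² , 𝟏) ∷ (ω² , 𝟏 , ω) ∷ (ω² , ω , 𝟏) ∷ []

-- α (0, 1, a, b, c) + β (1, 0, d, e, f) vanishes in coordinate 2 exactly when β = α a / d, so the
-- canonical line is simplex iff the ratios d / a, e / b, f / c are the three units in some order.
opaque
  simplexParams : List Params
  simplexParams =
    concatMap (λ a → concatMap (λ b → concatMap (λ c →
      map (λ (s , t , u) → a , b , c , a ⊗ s , b ⊗ t , c ⊗ u) unit-arrangements) units) units) units

  simplexParams-sound : All (λ p → SimplexLine (canonical p)) simplexParams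
  simplexParams-sound = by-evaluation (all? (λ p → simplexLine? (canonical p)) simplexParams) refl

  simplexParams-complete : ∀ p → SimplexLine (canonical p) → p ∈ simplexParams
  simplexParams-complete (a , b , c , d , e , f) sL =
    let (a≢0 , b≢0 , c≢0 , d≢0 , e≢0 , f≢0) = canonical-entries≢0 a b c d e f sL
    in check a a≢0 b b≢0 c c≢0 d d≢0 e e≢0 f f≢0 sL
    where
    check : ∀ a → a ≢ 𝟎 → ∀ b → b ≢ 𝟎 → ∀ c → c ≢ 𝟎 → ∀ d → d ≢ 𝟎 → ∀ e → e ≢ 𝟎 → ∀ f → f ≢ 𝟎 →
            SimplexLine (canonical (a , b , c , d , e , f)) → (a , b , c , d , e , f) ∈ simplexParams
    check = by-evaluation (∀unit? λ a → ∀unit? λ b → ∀unit? λ c → ∀unit? λ d → ∀unit? λ e → ∀unit? λ f →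
      simplexLine? (canonical (a , b , c , d , e , f)) →-dec ((a , b , c , d , e , f) ∈? simplexParams)) refl

-- Distance at most 2 in Γ

-- M ranges over canonical simplex lines only: every simplex line equals one of them.
Near : Line → Line → Set
Near K N = Any (λ p → Meets K (canonical p) × Meets (canonical p) N) simplexParams

near? : ∀ K q → Dec (Near K (canonical q))
near? K q = any? (λ p → meets? K (canonical p) (∈canonical? p) ×-dec
                        meets? (canonical p) (canonical q) (∈canonical? q))
                 simplexParams

ShortWalk : Line → Line → Set
ShortWalk K N = ∃ λ n → n ≤ 2 × Walk K N n

near-intro : ∀ {K} M {N} → SimplexLine M → Meets K M → Meets M N → Near K N
near-intro {K} M {N} sM KM MN with normal-form M sM
... | p , M≈p = Any.map (λ { refl → Meets-respʳ {K} M≈p KM , Meets-respˡ {N = N} M≈p MN })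
                        (simplexParams-complete p (SimplexLine-resp M≈p sM))

Walk⇒Near : ∀ {K N n} → Walk K N n → n ≤ 2 → Near K N
Walk⇒Near (here {K} {N} sK K≈N) _ =
  near-intro {K} K {N} sK (Meets-self K) (Meets-respʳ {K} (mk≈L {K} {N} K≈N) (Meets-self K))
Walk⇒Near (step {K} {M} (_ , sM , _ , KM) (here {_} {N} _ M≈N)) _ =
  near-intro {K} M {N} sM KM (Meets-respʳ {M} (mk≈L {M} {N} M≈N) (Meets-self M))
Walk⇒Near (step {K} {M} (_ , sM , _ , KM) (step {_} {M'} (_ , _ , _ , MM') (here {_} {N} _ M'≈N))) _ =
  near-intro {K} M {N} sM KM (Meets-respʳ {M} (mk≈L {M'} {N} M'≈N) MM')
Walk⇒Near (step _ (step _ (step _ _))) (s≤s (s≤s ()))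

adjacent : ∀ {L M} → SimplexLine L → SimplexLine M → ¬ L ≈L M → Meets L M → Adj L M
adjacent {L} {M} sL sM L≉M LM = sL , sM , (λ L≈M → L≉M (mk≈L {L} {M} L≈M)) , LM

edge : ∀ {L M} → SimplexLine L → SimplexLine M → ¬ L ≈L M → Meets L M → Walk L M 1
edge {L} {M} sL sM L≉M LM = step (adjacent {L} {M} sL sM L≉M LM) (here {M} {M} sM (sameLine (≈L-refl {M})))

walk-via : ∀ {K M N} → SimplexLine K → SimplexLine M → SimplexLine N → Meets K M → Meets M N → ShortWalk K N
walk-via {K} {M} {N} sK sM sN KM MN = by-cases (K ≈L? N) (K ≈L? M) (M ≈L? N)
  where
  by-cases : Dec (K ≈L N) → Dec (K ≈L M) → Dec (M ≈L N) → ShortWalk K N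
  by-cases (yes K≈N) _         _         = 0 , z≤n , here {K} {N} sK (sameLine K≈N)
  by-cases (no  K≉N) (yes K≈M) _         =
    1 , s≤s z≤n , edge {K} {N} sK sN K≉N (Meets-respˡ {M} {K} {N} (≈L-sym K≈M) MN)
  by-cases (no  K≉N) (no  _)   (yes M≈N) =
    1 , s≤s z≤n , edge {K} {N} sK sN K≉N (Meets-respʳ {K} {M} {N} M≈N KM)
  by-cases (no  K≉N) (no  K≉M) (no  M≉N) =
    2 , s≤s (s≤s z≤n) , step {K} {M} {N} (adjacent {K} {M} sK sM K≉M KM) (edge {M} {N} sM sN M≉N MN)

Near⇒ShortWalk : ∀ {K N} → SimplexLine K → SimplexLine N → Near K N → ShortWalk K N
Near⇒ShortWalk {K} {N} sK sN near = via (find near)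
  where
  via : (∃ λ p → p ∈ simplexParams × Meets K (canonical p) × Meets (canonical p) N) → ShortWalk K N
  via (p , p∈ , KM , MN) = walk-via {K} {canonical p} {N} sK (All.lookup simplexParams-sound p∈) sN KM MN

FarApart⇔¬Near : ∀ {K N} → SimplexLine K → SimplexLine N → FarApart K N ⇔ (¬ Near K N)
FarApart⇔¬Near {K} {N} sK sN = mk⇔
  (λ far near → no-short-walk far (Near⇒ShortWalk {K} {N} sK sN near))
  (λ ¬near n n≤2 w → ¬near (Walk⇒Near w n≤2))
  where
  no-short-walk : FarApart K N → ¬ ShortWalk K N
  no-short-walk far (n , n≤2 , w) = far n n≤2 w

base : F4 → F4 → Params
base x y = 𝟏 , 𝟏 , 𝟏 , 𝟏 , x , y

base-simplex : ∀ x y → SimplexLine (canonical (base x y)) → ((x , y) ≡ (ω , ω²)) ⊎ ((x , y) ≡ (ω² , ω))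
base-simplex = by-evaluation (∀F4? λ x → ∀F4? λ y → simplexLine? (canonical (base x y)) →-dec
  (((x , y) ≟₂ (ω , ω²)) ⊎-dec ((x , y) ≟₂ (ω² , ω)))) refl
  where
  _≟₂_ : DecidableEquality (F4 × F4)
  _≟₂_ = Product.≡-dec _≟F_ _≟F_

Characterised : Line → Params → Set
Characterised K q = Condition1 K (canonical q) ⇔ (¬ Near K (canonical q))

characterised? : ∀ K q → Dec (Characterised K q)
characterised? K q = condition1? K (canonical q) ⇔? ¬? (near? K q)

opaque
  unfolding simplexParams

  characterised₁ : All (Characterised (canonical (base ω ω²))) simplexParams
  characterised₁ = by-evaluation (all? (characterised? (canonical (base ω ω²))) simplexParams) refl

  characterised₂ : All (Characterised (canonical (base ω² ω))) simplexParams
  characterised₂ = by-evaluation (all? (characterised? (canonical (base ω² ω))) simplexParams) refl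

base-characterised : ∀ {x y} → ((x , y) ≡ (ω , ω²)) ⊎ ((x , y) ≡ (ω² , ω)) →
                     All (Characterised (canonical (base x y))) simplexParams
base-characterised (inj₁ refl) = characterised₁
base-characterised (inj₂ refl) = characterised₂

base-characterisation : ∀ x y → SimplexLine (canonical (base x y)) → ∀ N → SimplexLine N →
                        Condition1 (canonical (base x y)) N ⇔ FarApart (canonical (base x y)) N
base-characterisation x y sK N sN = begin
  Condition1 K N             ≈⟨ Condition1-cong (≈L-refl {K}) N≈q ⟩
  Condition1 K (canonical q) ≈⟨ All.lookup (base-characterised (base-simplex x y sK))
                                           (simplexParams-complete q sq) ⟩
  (¬ Near K (canonical q))   ≈⟨ FarApart⇔¬Near {K} {canonical q} sK sq ⟨
  FarApart K (canonical q)   ≈⟨ FarApart-cong (≈L-refl {K}) N≈q ⟨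
  FarApart K N               ∎
  where
  open ⇔-Reasoning
  K : Line
  K = canonical (base x y)
  q : Params
  q = proj₁ (normal-form N sN)
  N≈q : N ≈L canonical q
  N≈q = proj₂ (normal-form N sN)
  sq : SimplexLine (canonical q)
  sq = SimplexLine-resp N≈q sN

∷₅-cong : ∀ {x₀ x₁ x₂ x₃ x₄ y₀ y₁ y₂ y₃ y₄ : F4} → x₀ ≡ y₀ → x₁ ≡ y₁ → x₂ ≡ y₂ → x₃ ≡ y₃ → x₄ ≡ y₄ →
         _≡_ {A = V} (x₀ ∷ x₁ ∷ x₂ ∷ x₃ ∷ x₄ ∷ []) (y₀ ∷ y₁ ∷ y₂ ∷ y₃ ∷ y₄ ∷ [])
∷₅-cong refl refl refl refl refl = refl

record BaseForm (L : Line) : Set where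
  field
    diagonal : Diagonal
    x y      : F4
    ≈base    : (diagonal ⊙L L) ≈L canonical (base x y)

-- With s = d / a, the diagonal map (s, 1, 1/a, 1/b, 1/c) sends (0, 1, a, b, c) to (0, 1, 1, 1, 1)
-- and (1, 0, d, e, f) to s (1, 0, 1, x, y).
canonical-base-form : ∀ p → SimplexLine (canonical p) → BaseForm (canonical p)
canonical-base-form p@(a , b , c , d , e , f) sP = record { diagonal = D ; x = x ; y = y ; ≈base =
  canonical-≈ DP (base x y) (SimplexLine-⊙L D (canonical p) sP)
    (subst (_∈L DP) (∷₅-cong (x⊗𝟎≡𝟎 s) refl (inv-inverseˡ a a≢0) (inv-inverseˡ b b≢0) (inv-inverseˡ c c≢0))
           (u∈L DP))
    (subst (_∈L DP) (∷₅-cong (inv-cancelˡ s 𝟏 s≢0) (x⊗𝟎≡𝟎 (inv s)) (inv-inverseˡ s s≢0) refl refl)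
           (∈L-scale DP (inv s) (v∈L DP))) }
  where
  a≢0 : a ≢ 𝟎
  a≢0 = proj₁ (canonical-entries≢0 a b c d e f sP)
  b≢0 : b ≢ 𝟎
  b≢0 = proj₁ (proj₂ (canonical-entries≢0 a b c d e f sP))
  c≢0 : c ≢ 𝟎
  c≢0 = proj₁ (proj₂ (proj₂ (canonical-entries≢0 a b c d e f sP)))
  d≢0 : d ≢ 𝟎
  d≢0 = proj₁ (proj₂ (proj₂ (proj₂ (canonical-entries≢0 a b c d e f sP))))

  s x y : F4
  s = inv a ⊗ d
  x = inv s ⊗ (inv b ⊗ e)
  y = inv s ⊗ (inv c ⊗ f)

  s≢0 : s ≢ 𝟎
  s≢0 = ⊗-≢0 (inv a) d (inv-≢0 a a≢0) d≢0

  scales≢0 : ∀ j → lookup (s ∷ 𝟏 ∷ inv a ∷ inv b ∷ inv c ∷ []) j ≢ 𝟎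
  scales≢0 zero                         = s≢0
  scales≢0 (suc zero)                   = λ ()
  scales≢0 (suc (suc zero))             = inv-≢0 a a≢0
  scales≢0 (suc (suc (suc zero)))       = inv-≢0 b b≢0
  scales≢0 (suc (suc (suc (suc zero)))) = inv-≢0 c c≢0

  D : Diagonal
  D = diag (s ∷ 𝟏 ∷ inv a ∷ inv b ∷ inv c ∷ []) scales≢0

  DP : Line
  DP = D ⊙L canonical p

BaseForm-resp : ∀ {L M} → L ≈L M → BaseForm M → BaseForm L
BaseForm-resp {L} {M} L≈M form =
  record { diagonal = D ; x = x ; y = y ; ≈base = ≈L-trans (⊙L-cong D {L} {M} L≈M) ≈base }
  where open BaseForm form renaming (diagonal to D)

base-form : ∀ L → SimplexLine L → BaseForm L
base-form L sL = BaseForm-resp L≈P (canonical-base-form p (SimplexLine-resp L≈P sL))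
  where
  p : Params
  p = proj₁ (normal-form L sL)
  L≈P : L ≈L canonical p
  L≈P = proj₂ (normal-form L sL)

lemma1 : (L L' : Line) → SimplexLine L → SimplexLine L' → (Condition1 L L' ⇔ FarApart L L')
lemma1 L L' sL sL' = begin
  Condition1 L L'                 ≈⟨ Condition1-⊙L D {L} {L'} ⟩
  Condition1 (D ⊙L L) (D ⊙L L')   ≈⟨ Condition1-cong ≈base (≈L-refl {D ⊙L L'}) ⟩
  Condition1 K (D ⊙L L')          ≈⟨ base-characterisation x y sK (D ⊙L L') (SimplexLine-⊙L D L' sL') ⟩
  FarApart K (D ⊙L L')            ≈⟨ FarApart-cong ≈base (≈L-refl {D ⊙L L'}) ⟨
  FarApart (D ⊙L L) (D ⊙L L')     ≈⟨ FarApart-⊙L D {L} {L'} ⟨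
  FarApart L L'                   ∎
  where
  open ⇔-Reasoning
  open BaseForm (base-form L sL) renaming (diagonal to D)
  K : Line
  K = canonical (base x y)
  sK : SimplexLine K
  sK = SimplexLine-resp ≈base (SimplexLine-⊙L D L sL)
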